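{- Let $c\geq 0$ and $b\geq 2$ be integers. Let $a\in\mathbb{Z}^+$ have exactly $n+1>3$ digits in base $b$ and satisfy $S_{[c,b]}(a)=a$. Let $\hat c\geq 0$ be an integer such that $c$ and $\hat c$ lie in a common oasis base $b$ (i.e., for every integer $t$ between $c$ and $\hat c$ inclusive, $S_{[t,b]}$ has a fixed point). Then every fixed point of $S_{[\hat c,b]}$ has exactly $n+1$ digits in base $b$.
   Context: For integers $c\geq 0$ and $b\geq 2$, the augmented generalized happy function $S_{[c,b]}:\mathbb{Z}^+\to\mathbb{Z}^+$ is defined by $S_{[c,b]}\left(\sum_{i=0}^n a_i b^i\right)=c+\sum_{i=0}^n a_i^2$, where $0\le a_i\le b-1$, $a_n\neq 0$ (the base $b$ expansion; such a number has $n+1$ digits). A positive integer $a$ is a fixed point of $S_{[c,b]}$ if $S_{[c,b]}(a)=a$. An oasis base $b$ is a set of consecutive non-negative integers $c$ such that for each of them $S_{[c,b]}$ has at least one fixed point. -}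

module Defs where

open import Data.Nat using (ℕ; zero; suc; _+_; _*_; _≤_; _<_)
open import Data.Nat.DivMod using (_/_; _%_)
open import Data.List using (List; []; _∷_; length; map)
open import Data.Nat.ListAction using (sum)
open import Data.Product using (_×_; ∃-syntax)
open import Relation.Binary.PropositionalEquality using (_≡_)

-- Base-b digits of a (least significant first), with no leading zeros;
-- digits b 0 = [].  Uses fuel (a itself suffices since a / b < a for b ≥ 2).
-- For b < 2 the value is irrelevant (the statement assumes 2 ≤ b); we
-- return [] there.
digitsFuel : ℕ → ℕ → ℕ → List ℕ
digitsFuel zero          _ _       = []
digitsFuel (suc f)       b zero    = []
digitsFuel (suc f) zero          (suc a) = []
digitsFuel (suc f) (suc zero)    (suc a) = []
digitsFuel (suc f) (suc (suc k)) (suc a) =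
  (suc a % suc (suc k)) ∷ digitsFuel f (suc (suc k)) (suc a / suc (suc k))

digits : ℕ → ℕ → List ℕ
digits b a = digitsFuel a b a

numDigits : ℕ → ℕ → ℕ
numDigits b a = length (digits b a)

S : ℕ → ℕ → ℕ → ℕ
S c b a = c + sum (map (λ d → d * d) (digits b a))

IsFixedPoint : ℕ → ℕ → ℕ → Set
IsFixedPoint c b a = (1 ≤ a) × (S c b a ≡ a)

HasFixedPoint : ℕ → ℕ → Set
HasFixedPoint c b = ∃[ a ] IsFixedPoint c b a

-- Write Δ x = x - (sum of the squared base-b digits of x), so that x is a fixed point of
-- S_[t,b] exactly when Δ x = t, and let q = (b - 1)(b - 2).  If b ^ j ≤ x then
-- Δ x ≥ b ^ j - q - 1: the leading digit alone contributes at least b ^ j - 1, every other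
-- digit except the last contributes a nonnegative amount, and the last one loses at most q.
-- If x < b ^ j with j ≥ 3 then Δ x ≤ b ^ j - q - 3, by induction on j from a direct
-- three-digit estimate.  Hence S_[t,b] has no fixed point for t = b ^ j - q - 2, its fixed points
-- have more than j digits when t is larger and at most j digits when t is smaller.  Two fixed
-- points for c and ĉ with different digit counts would therefore put such a value t strictly
-- between c and ĉ, which the oasis hypothesis forbids.
module Submission where

open import Defs
open import Data.Nat using (ℕ; suc; _≤_; _<_; _⊓_; _⊔_)
open import Relation.Binary.PropositionalEquality using (_≡_)

open import Data.Nat using (zero; _+_; _*_; _^_; _∸_; z≤n; s≤s; _<?_)
open import Data.Nat.Properties
open import Algebra.Properties.CommutativeSemigroup +-commutativeSemigroup using (x∙yz≈y∙xz; xy∙z≈xz∙y)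
open import Data.Nat.DivMod
  using (_/_; _%_; m≡m%n+[m/n]*n; m%n<n; m/n<m; m<n*o⇒m/o<n; [m+kn]%n≡m%n; m<n⇒m%n≡m;
         +-distrib-/-∣ʳ; m<n⇒m/n≡0; m*n/n≡m)
open import Data.Nat.Divisibility using (n∣m*n)
open import Data.Nat.Induction using (<-rec)
open import Data.Nat.Tactic.RingSolver using (solve-∀)
open import Data.List using (_∷_; length; map)
open import Data.Nat.ListAction using (sum)
open import Data.Product using (_,_)
open import Data.Empty using (⊥-elim)
open import Relation.Nullary using (¬_; yes; no)
open import Relation.Binary.PropositionalEquality using (refl; sym; trans; cong; cong₂; subst)
open import Relation.Binary.Definitions using (tri<; tri≈; tri>)

m+o≡n⇒m≤n : ∀ {m n} o → m + o ≡ n → m ≤ n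
m+o≡n⇒m≤n {m} o refl = m≤m+n m o

n≤n*n : ∀ n → n ≤ n * n
n≤n*n zero    = z≤n
n≤n*n (suc n) = m≤m+n (suc n) (n * suc n)

m≤n⇒m*[1+n]²+n²≤n*[1+n]²+m² : ∀ {m n} → m ≤ n → m * suc n * suc n + n * n ≤ n * suc n * suc n + m * m
m≤n⇒m*[1+n]²+n²≤n*[1+n]²+m² {m} m≤n =
  let o , m+o≡n = m≤n⇒∃[o]m+o≡n m≤n in
  subst (λ n → m * suc n * suc n + n * n ≤ n * suc n * suc n + m * m) m+o≡n
        (m+o≡n⇒m≤n (o * ((m + o) * (m + o) + o + 1)) (identity m o))
  where
  identity : ∀ m o → let n = m + o in
             m * suc n * suc n + n * n + o * (n * n + o + 1) ≡ n * suc n * suc n + m * m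
  identity = solve-∀

module Base (k : ℕ) where

  open ≤-Reasoning

  b : ℕ
  b = suc (suc k)

  -- (b - 1)(b - 2), the largest value of d * d - d over digits d < b
  q : ℕ
  q = suc k * k

  digitSquareSum : ℕ → ℕ
  digitSquareSum x = sum (map (λ d → d * d) (digits b x))

  suc/b≤ : ∀ x → suc x / b ≤ x
  suc/b≤ x = ≤-pred (m/n<m (suc x) b (s≤s (s≤s z≤n)))

  digitsFuel-irrelevant : ∀ f g x → x ≤ f → x ≤ g → digitsFuel f b x ≡ digitsFuel g b x
  digitsFuel-irrelevant zero    zero    zero    _       _       = refl
  digitsFuel-irrelevant zero    (suc g) zero    _       _       = refl
  digitsFuel-irrelevant (suc f) zero    zero    _       _       = refl
  digitsFuel-irrelevant (suc f) (suc g) zero    _       _       = refl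
  digitsFuel-irrelevant (suc f) (suc g) (suc x) (s≤s p) (s≤s p′) =
    cong (suc x % b ∷_) (digitsFuel-irrelevant f g (suc x / b)
      (≤-trans (suc/b≤ x) p) (≤-trans (suc/b≤ x) p′))

  digits-suc : ∀ x → digits b (suc x) ≡ suc x % b ∷ digits b (suc x / b)
  digits-suc x = cong (suc x % b ∷_) (digitsFuel-irrelevant x (suc x / b) (suc x / b) (suc/b≤ x) ≤-refl)

  numDigits-suc : ∀ x → numDigits b (suc x) ≡ suc (numDigits b (suc x / b))
  numDigits-suc x = cong length (digits-suc x)

  digitSquareSum-%/ : ∀ x → digitSquareSum x ≡ x % b * (x % b) + digitSquareSum (x / b)
  digitSquareSum-%/ zero    = refl
  digitSquareSum-%/ (suc x) = cong (λ ds → sum (map (λ d → d * d) ds)) (digits-suc x)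

  <b^⇒numDigits≤ : ∀ j x → x < b ^ j → numDigits b x ≤ j
  <b^⇒numDigits≤ j       zero    _ = z≤n
  <b^⇒numDigits≤ zero    (suc x) (s≤s ())
  <b^⇒numDigits≤ (suc j) (suc x) h = begin
    numDigits b (suc x)            ≡⟨ numDigits-suc x ⟩
    suc (numDigits b (suc x / b))  ≤⟨ s≤s (<b^⇒numDigits≤ j (suc x / b)
                                          (m<n*o⇒m/o<n (subst (suc x <_) (*-comm b (b ^ j)) h))) ⟩
    suc j                          ∎

  numDigits≤⇒<b^ : ∀ j x → numDigits b x ≤ j → x < b ^ j
  numDigits≤⇒<b^ j       zero    _ = m^n>0 b j
  numDigits≤⇒<b^ (suc j) (suc x) h = begin-strict
    suc x                  ≡⟨ m≡m%n+[m/n]*n (suc x) b ⟩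
    suc x % b + y * b      <⟨ +-monoˡ-< (y * b) (m%n<n (suc x) b) ⟩
    suc y * b              ≤⟨ *-monoˡ-≤ b (numDigits≤⇒<b^ j y (≤-pred (subst (_≤ suc j) (numDigits-suc x) h))) ⟩
    b ^ j * b              ≡⟨ *-comm (b ^ j) b ⟩
    b ^ suc j              ∎
    where y = suc x / b

  data LastDigit : ℕ → Set where
    lastDigit : ∀ e z → e < b → LastDigit (e + z * b)

  viewLastDigit : ∀ x → LastDigit x
  viewLastDigit x = subst LastDigit (sym (m≡m%n+[m/n]*n x b)) (lastDigit (x % b) (x / b) (m%n<n x b))

  digitSquareSum-lastDigit : ∀ {e} z → e < b → digitSquareSum (e + z * b) ≡ e * e + digitSquareSum z
  digitSquareSum-lastDigit {e} z e<b = begin-equality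
    digitSquareSum (e + z * b)                                  ≡⟨ digitSquareSum-%/ (e + z * b) ⟩
    (e + z * b) % b * ((e + z * b) % b) + digitSquareSum ((e + z * b) / b)
                                                                ≡⟨ cong₂ (λ d y → d * d + digitSquareSum y) remainder quotient ⟩
    e * e + digitSquareSum z                                    ∎
    where
    remainder : (e + z * b) % b ≡ e
    remainder = trans ([m+kn]%n≡m%n e z b) (m<n⇒m%n≡m e<b)
    quotient : (e + z * b) / b ≡ z
    quotient = begin-equality
      (e + z * b) / b    ≡⟨ +-distrib-/-∣ʳ e (n∣m*n z) ⟩
      e / b + z * b / b  ≡⟨ cong₂ _+_ (m<n⇒m/n≡0 e<b) (m*n/n≡m z b) ⟩
      z                  ∎

  e*e≤e+q : ∀ {e} → e < b → e * e ≤ e + q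
  e*e≤e+q {zero}  _               = z≤n
  e*e≤e+q {suc e} (s≤s (s≤s e≤k)) = +-monoʳ-≤ (suc e) (begin
    e * suc e    ≤⟨ *-mono-≤ e≤k (s≤s e≤k) ⟩
    k * suc k    ≡⟨ *-comm k (suc k) ⟩
    q            ∎)

  b+e*e≤e*b+1 : ∀ {e} → 0 < e → e < b → b + e * e ≤ e * b + 1
  b+e*e≤e*b+1 {suc e} _ (s≤s (s≤s e≤k)) with m≤n⇒∃[o]m+o≡n e≤k
  ... | r , refl = m+o≡n⇒m≤n (r * e) (identity e r)
    where
    identity : ∀ e r → suc (suc (e + r)) + suc e * suc e + r * e ≡ suc e * suc (suc (e + r)) + 1
    identity = solve-∀

  b*m≤e+z*b⇒m≤z : ∀ {m e z} → e < b → b * m ≤ e + z * b → m ≤ z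
  b*m≤e+z*b⇒m≤z {m} {e} {z} e<b h = ≤-pred (*-cancelʳ-< b m (suc z) (begin-strict
    m * b      ≡⟨ *-comm m b ⟩
    b * m      ≤⟨ h ⟩
    e + z * b  <⟨ +-monoˡ-< (z * b) e<b ⟩
    b + z * b  ∎))

  e+z*b<b*m⇒z<m : ∀ {m e z} → e + z * b < b * m → z < m
  e+z*b<b*m⇒z<m {m} {e} {z} h = *-cancelʳ-< b z m (begin-strict
    z * b      ≤⟨ m≤n+m (z * b) e ⟩
    e + z * b  <⟨ h ⟩
    b * m      ≡⟨ *-comm b m ⟩
    m * b      ∎)

  digitSquareSum-digit : ∀ {e} → e < b → digitSquareSum e ≡ e * e
  digitSquareSum-digit {e} e<b = begin-equality
    digitSquareSum e            ≡⟨ cong digitSquareSum (sym (+-identityʳ e)) ⟩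
    digitSquareSum (e + 0 * b)  ≡⟨ digitSquareSum-lastDigit 0 e<b ⟩
    e * e + 0                   ≡⟨ +-identityʳ (e * e) ⟩
    e * e                       ∎

  higherDigits≤ : ∀ {e} z → (∀ {w} → w < e + z * b → digitSquareSum w ≤ w * b) →
                  digitSquareSum z ≤ z * b * b
  higherDigits≤         zero    _   = z≤n
  higherDigits≤ {e} z@(suc _) rec = ≤-trans (rec (begin-strict
    z          <⟨ m<m*n z b (s≤s (s≤s z≤n)) ⟩
    z * b      ≤⟨ m≤n+m (z * b) e ⟩
    e + z * b  ∎)) (m≤m*n (z * b) b)

  digitSquareSum≤*b : ∀ y → digitSquareSum y ≤ y * b
  digitSquareSum≤*b = <-rec _ bound
    where
    bound : ∀ y → (∀ {w} → w < y → digitSquareSum w ≤ w * b) → digitSquareSum y ≤ y * b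
    bound y rec with viewLastDigit y
    ... | lastDigit e z e<b = begin
      digitSquareSum (e + z * b)  ≡⟨ digitSquareSum-lastDigit z e<b ⟩
      e * e + digitSquareSum z    ≤⟨ +-mono-≤ (*-monoʳ-≤ e (<⇒≤ e<b)) (higherDigits≤ z rec) ⟩
      e * b + z * b * b           ≡⟨ *-distribʳ-+ b e (z * b) ⟨
      (e + z * b) * b             ∎

  -- digitSquareSum-upper for the number y * b, whose last digit 0 costs no q
  digitSquareSum-upper-shifted : ∀ j y → b ^ j ≤ y → b ^ suc j + digitSquareSum y ≤ y * b + 1
  digitSquareSum-upper-shifted j y h with viewLastDigit y
  digitSquareSum-upper-shifted zero _ h | lastDigit e zero e<b = begin
    b * 1 + digitSquareSum (e + 0)  ≡⟨ cong₂ _+_ (*-identityʳ b) (digitSquareSum-lastDigit 0 e<b) ⟩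
    b + (e * e + 0)                 ≡⟨ cong (b +_) (+-identityʳ (e * e)) ⟩
    b + e * e                       ≤⟨ b+e*e≤e*b+1 (subst (0 <_) (+-identityʳ e) h) e<b ⟩
    e * b + 1                       ≡⟨ cong (λ d → d * b + 1) (+-identityʳ e) ⟨
    (e + 0) * b + 1                 ∎
  digitSquareSum-upper-shifted zero _ h | lastDigit e z@(suc z′) e<b = begin
    b * 1 + digitSquareSum (e + z * b)  ≡⟨ cong (b * 1 +_) (digitSquareSum-lastDigit z e<b) ⟩
    b * 1 + (e * e + digitSquareSum z)  ≤⟨ +-monoʳ-≤ (b * 1) (+-mono-≤ (*-monoʳ-≤ e (<⇒≤ e<b)) (digitSquareSum≤*b z)) ⟩
    b * 1 + (e * b + z * b)             ≤⟨ m+o≡n⇒m≤n _ (identity k e z′) ⟩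
    (e + z * b) * b + 1                 ∎
    where
    identity : ∀ k e z′ → let b = suc (suc k) in
               b * 1 + (e * b + suc z′ * b) + (b * (z′ * suc k + k) + 1) ≡ (e + suc z′ * b) * b + 1
    identity = solve-∀
  digitSquareSum-upper-shifted (suc j) _ h | lastDigit e z e<b = begin
    b * (b * P) + digitSquareSum (e + z * b)        ≡⟨ cong (b * (b * P) +_) (digitSquareSum-lastDigit z e<b) ⟩
    b * (b * P) + (e * e + digitSquareSum z)        ≡⟨ identity₁ k P (e * e) (digitSquareSum z) ⟩
    e * e + (suc k * (b * P) + (b * P + digitSquareSum z))
        ≤⟨ +-mono-≤ (*-monoʳ-≤ e (<⇒≤ e<b))
                    (+-mono-≤ (*-monoʳ-≤ (suc k) (*-monoʳ-≤ b P≤z)) (digitSquareSum-upper-shifted j z P≤z)) ⟩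
    e * b + (suc k * (b * z) + (z * b + 1))         ≡⟨ identity₂ k e z ⟩
    (e + z * b) * b + 1                             ∎
    where
    P = b ^ j
    P≤z : P ≤ z
    P≤z = b*m≤e+z*b⇒m≤z e<b h
    identity₁ : ∀ k P s t → let b = suc (suc k) in b * (b * P) + (s + t) ≡ s + (suc k * (b * P) + (b * P + t))
    identity₁ = solve-∀
    identity₂ : ∀ k e z → let b = suc (suc k) in e * b + (suc k * (b * z) + (z * b + 1)) ≡ (e + z * b) * b + 1
    identity₂ = solve-∀

  digitSquareSum-upper : ∀ j x → b ^ j ≤ x → b ^ j + digitSquareSum x ≤ x + (1 + q)
  digitSquareSum-upper j x h with viewLastDigit x
  ... | lastDigit e z e<b = begin
    b ^ j + digitSquareSum (e + z * b)  ≡⟨ cong (b ^ j +_) (digitSquareSum-lastDigit z e<b) ⟩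
    b ^ j + (e * e + digitSquareSum z)  ≡⟨ x∙yz≈y∙xz (b ^ j) (e * e) (digitSquareSum z) ⟩
    e * e + (b ^ j + digitSquareSum z)  ≤⟨ +-mono-≤ (e*e≤e+q e<b) (higherDigits j h) ⟩
    (e + q) + (z * b + 1)               ≡⟨ identity e (z * b) q ⟩
    e + z * b + (1 + q)                 ∎
    where
    higherDigits : ∀ j → b ^ j ≤ e + z * b → b ^ j + digitSquareSum z ≤ z * b + 1
    higherDigits zero    _ = subst (_≤ z * b + 1) (+-comm (digitSquareSum z) 1) (+-monoˡ-≤ 1 (digitSquareSum≤*b z))
    higherDigits (suc j) h = digitSquareSum-upper-shifted j z (b*m≤e+z*b⇒m≤z e<b h)
    identity : ∀ e y q → (e + q) + (y + 1) ≡ e + y + (1 + q)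
    identity = solve-∀

  -- d ↦ d * b * b - d * d increases on digits, so the worst case is d = b - 1.
  leadingDigit-bound : ∀ {d} → d < b → suc k * b + (d * b * b + (3 + q)) ≤ b ^ 3 + d * d
  leadingDigit-bound {d} d<b = +-cancelʳ-≤ (suc k * suc k) _ _ (begin
    suc k * b + (d * b * b + (3 + q)) + suc k * suc k
        ≡⟨ identity₁ (suc k * b) (d * b * b) (3 + q) (suc k * suc k) ⟩
    suc k * b + (3 + q) + (d * b * b + suc k * suc k)
        ≤⟨ +-monoʳ-≤ (suc k * b + (3 + q)) (m≤n⇒m*[1+n]²+n²≤n*[1+n]²+m² (≤-pred d<b)) ⟩
    suc k * b + (3 + q) + (suc k * b * b + d * d)
        ≤⟨ m+o≡n⇒m≤n (2 * k) (identity₂ k d) ⟩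
    b ^ 3 + d * d + suc k * suc k
        ∎)
    where
    identity₁ : ∀ x y z w → x + (y + z) + w ≡ x + z + (y + w)
    identity₁ = solve-∀
    identity₂ : ∀ k d → let b = suc (suc k) in
                suc k * b + (3 + suc k * k) + (suc k * b * b + d * d) + 2 * k ≡ b * (b * (b * 1)) + d * d + suc k * suc k
    identity₂ = solve-∀

  digitSquareSum-lower : ∀ i x → x < b ^ (3 + i) → x + (3 + q) ≤ b ^ (3 + i) + digitSquareSum x
  digitSquareSum-lower zero x h with viewLastDigit x
  ... | lastDigit e₀ y e₀<b with viewLastDigit y
  ...   | lastDigit e₁ e₂ e₁<b = begin
    e₀ + (e₁ + e₂ * b) * b + (3 + q)                 ≡⟨ identity₁ e₀ e₁ e₂ b (3 + q) ⟩
    e₀ + (e₁ * b + (e₂ * b * b + (3 + q)))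
        ≤⟨ +-mono-≤ (n≤n*n e₀) (+-monoˡ-≤ _ (*-monoˡ-≤ b (≤-pred e₁<b))) ⟩
    e₀ * e₀ + (suc k * b + (e₂ * b * b + (3 + q)))  ≤⟨ +-monoʳ-≤ (e₀ * e₀) (leadingDigit-bound e₂<b) ⟩
    e₀ * e₀ + (b ^ 3 + e₂ * e₂)                      ≤⟨ m+o≡n⇒m≤n (e₁ * e₁) (identity₂ (e₀ * e₀) (b ^ 3) (e₁ * e₁) (e₂ * e₂)) ⟩
    b ^ 3 + (e₀ * e₀ + (e₁ * e₁ + e₂ * e₂))          ≡⟨ cong (λ s → b ^ 3 + (e₀ * e₀ + s)) digitSquareSum-y ⟨
    b ^ 3 + (e₀ * e₀ + digitSquareSum y)             ≡⟨ cong (b ^ 3 +_) (digitSquareSum-lastDigit y e₀<b) ⟨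
    b ^ 3 + digitSquareSum (e₀ + y * b)              ∎
    where
    e₂<b : e₂ < b
    e₂<b = subst (e₂ <_) (*-identityʳ b) (e+z*b<b*m⇒z<m {e = e₁} (e+z*b<b*m⇒z<m {e = e₀} h))
    digitSquareSum-y : digitSquareSum y ≡ e₁ * e₁ + e₂ * e₂
    digitSquareSum-y = trans (digitSquareSum-lastDigit e₂ e₁<b) (cong (e₁ * e₁ +_) (digitSquareSum-digit e₂<b))
    identity₁ : ∀ e₀ e₁ e₂ b c → e₀ + (e₁ + e₂ * b) * b + c ≡ e₀ + (e₁ * b + (e₂ * b * b + c))
    identity₁ = solve-∀
    identity₂ : ∀ s₀ P s₁ s₂ → s₀ + (P + s₂) + s₁ ≡ P + (s₀ + (s₁ + s₂))
    identity₂ = solve-∀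
  digitSquareSum-lower (suc i) x h with viewLastDigit x
  ... | lastDigit e y e<b = begin
    e + y * b + (3 + q)                            ≡⟨ identity₁ k e y (3 + q) ⟩
    e + (suc k * y + (y + (3 + q)))
        ≤⟨ +-mono-≤ (n≤n*n e) (+-mono-≤ (*-monoʳ-≤ (suc k) (<⇒≤ y<P)) (digitSquareSum-lower i y y<P)) ⟩
    e * e + (suc k * P + (P + digitSquareSum y))   ≡⟨ identity₂ k (e * e) P (digitSquareSum y) ⟩
    b * P + (e * e + digitSquareSum y)             ≡⟨ cong (b * P +_) (digitSquareSum-lastDigit y e<b) ⟨
    b * P + digitSquareSum (e + y * b)             ∎
    where
    P = b ^ (3 + i)
    y<P : y < P
    y<P = e+z*b<b*m⇒z<m h
    identity₁ : ∀ k e y c → e + y * suc (suc k) + c ≡ e + (suc k * y + (y + c))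
    identity₁ = solve-∀
    identity₂ : ∀ k s P t → s + (suc k * P + (P + t)) ≡ suc (suc k) * P + (s + t)
    identity₂ = solve-∀

  fixedPoint≥b^⇒b^≤t+[1+q] : ∀ {t y} j → b ^ j ≤ y → S t b y ≡ y → b ^ j ≤ t + (1 + q)
  fixedPoint≥b^⇒b^≤t+[1+q] {t} {y} j h fix = +-cancelʳ-≤ (digitSquareSum y) (b ^ j) (t + (1 + q)) (begin
    b ^ j + digitSquareSum y          ≤⟨ digitSquareSum-upper j y h ⟩
    y + (1 + q)                       ≡⟨ cong (_+ (1 + q)) fix ⟨
    t + digitSquareSum y + (1 + q)    ≡⟨ xy∙z≈xz∙y t (digitSquareSum y) (1 + q) ⟩
    t + (1 + q) + digitSquareSum y    ∎)

  fixedPoint<b^⇒t+[3+q]≤b^ : ∀ {t y} i → y < b ^ (3 + i) → S t b y ≡ y → t + (3 + q) ≤ b ^ (3 + i)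
  fixedPoint<b^⇒t+[3+q]≤b^ {t} {y} i h fix = +-cancelʳ-≤ (digitSquareSum y) (t + (3 + q)) (b ^ (3 + i)) (begin
    t + (3 + q) + digitSquareSum y    ≡⟨ xy∙z≈xz∙y t (digitSquareSum y) (3 + q) ⟨
    t + digitSquareSum y + (3 + q)    ≡⟨ cong (_+ (3 + q)) fix ⟩
    y + (3 + q)                       ≤⟨ digitSquareSum-lower i y h ⟩
    b ^ (3 + i) + digitSquareSum y    ∎)

  noFixedPoint : ∀ i {t} → t + (2 + q) ≡ b ^ (3 + i) → ¬ HasFixedPoint t b
  noFixedPoint i {t} t+2+q≡P (y , _ , fix) with y <? b ^ (3 + i)
  ... | yes y<P = n≮n (2 + q) (+-cancelˡ-≤ t (3 + q) (2 + q)
                    (subst (t + (3 + q) ≤_) (sym t+2+q≡P) (fixedPoint<b^⇒t+[3+q]≤b^ i y<P fix)))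
  ... | no  y≮P = n≮n (1 + q) (+-cancelˡ-≤ t (2 + q) (1 + q)
                    (subst (_≤ t + (1 + q)) (sym t+2+q≡P) (fixedPoint≥b^⇒b^≤t+[1+q] (3 + i) (≮⇒≥ y≮P) fix)))

  fixedPoint-digitCount-gap : ∀ i {lo hi y z} →
    S lo b y ≡ y → numDigits b y ≤ 3 + i → S hi b z ≡ z → 3 + i < numDigits b z →
    ¬ (∀ t → lo < t → t < hi → HasFixedPoint t b)
  fixedPoint-digitCount-gap i {lo} {hi} {y} {z} fixY fewer fixZ more fixedPoints =
    noFixedPoint i t+2+q≡P (fixedPoints t lo<t t<hi)
    where
    P = b ^ (3 + i)
    lo+3+q≤P : lo + (3 + q) ≤ P
    lo+3+q≤P = fixedPoint<b^⇒t+[3+q]≤b^ i (numDigits≤⇒<b^ (3 + i) y fewer) fixY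
    P≤hi+1+q : P ≤ hi + (1 + q)
    P≤hi+1+q = fixedPoint≥b^⇒b^≤t+[1+q] (3 + i) (≮⇒≥ (λ z<P → <⇒≱ more (<b^⇒numDigits≤ (3 + i) z z<P))) fixZ
    t = P ∸ (2 + q)
    t+2+q≡P : t + (2 + q) ≡ P
    t+2+q≡P = m∸n+n≡m (≤-trans (n≤1+n (2 + q)) (≤-trans (m≤n+m (3 + q) lo) lo+3+q≤P))
    lo<t : lo < t
    lo<t = m+n≤o⇒m≤o∸n (suc lo) (subst (_≤ P) (+-suc lo (2 + q)) lo+3+q≤P)
    t<hi : t < hi
    t<hi = +-cancelʳ-≤ (1 + q) (suc t) hi (subst (_≤ hi + (1 + q)) (trans (sym t+2+q≡P) (+-suc t (1 + q))) P≤hi+1+q)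

theorem5 : (c b : ℕ) → 2 ≤ b → (a n : ℕ) → 3 < suc n → numDigits b a ≡ suc n → IsFixedPoint c b a → (ĉ : ℕ) → (∀ t → c ⊓ ĉ ≤ t → t ≤ c ⊔ ĉ → HasFixedPoint t b) → ∀ x → IsFixedPoint ĉ b x → numDigits b x ≡ suc n
theorem5 c b@(suc (suc k)) (s≤s (s≤s z≤n)) a n (s≤s (s≤s (s≤s (s≤s {n = i} z≤n)))) digitsA (_ , fixA) ĉ oasis x (_ , fixX)
  with <-cmp (numDigits b x) (suc n)
... | tri≈ _ same _ = same
... | tri< fewer _ _ = ⊥-elim (Base.fixedPoint-digitCount-gap k i fixX (≤-pred fewer) fixA (≤-reflexive (sym digitsA))
        λ t ĉ<t t<c → oasis t (≤-trans (m⊓n≤n c ĉ) (<⇒≤ ĉ<t)) (≤-trans (<⇒≤ t<c) (m≤m⊔n c ĉ)))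
... | tri> _ _ more = ⊥-elim (Base.fixedPoint-digitCount-gap k (suc i) fixA (≤-reflexive digitsA) fixX more
        λ t c<t t<ĉ → oasis t (≤-trans (m⊓n≤m c ĉ) (<⇒≤ c<t)) (≤-trans (<⇒≤ t<ĉ) (m≤n⊔m c ĉ)))
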